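{- Let $f \in \mathbb{Z}[T, Y]$ be monic in $Y$, of degree $d_T$ in $T$ and degree $d_Y$ in $Y$. Let $t = a/b \in \mathbb{Q}$ be written in lowest terms, and let $y \in \mathbb{Q}$ satisfy $f(t, y) = 0$. Then $y = c/b^{d_T}$ for some $c \in \mathbb{Z}$ with $|c| \leq 2(d_T + 1)\|f\| H(t)^{d_T}$.
   Context: The height of $t = a/b$ in lowest terms is $H(t) = \max(|a|,|b|)$. $\|f\|$ denotes the maximum of $2$ and the absolute values of the coefficients of $f$. -}

module Defs where

open import Data.Nat as ℕ using (ℕ; zero; suc; _⊔_)
open import Data.Integer as ℤ using (ℤ; +_; ∣_∣)
open import Data.Fin using (Fin; zero; suc)
open import Data.Rational as ℚ using (ℚ; 0ℚ; 1ℚ; _*_; _+_; ↥_; ↧ₙ_)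

-- A polynomial f ∈ ℤ[T,Y] with deg_T f ≤ dT and deg_Y f ≤ dY is given by its
-- coefficient table: coefficient of T^i Y^j is (f i j).
Poly2 : ℕ → ℕ → Set
Poly2 dT dY = Fin (suc dT) → Fin (suc dY) → ℤ

sumFin : ∀ {n} → (Fin n → ℚ) → ℚ
sumFin {zero}  g = 0ℚ
sumFin {suc n} g = g zero + sumFin (λ i → g (suc i))

maxFin : ∀ {n} → (Fin n → ℕ) → ℕ
maxFin {zero}  g = 0
maxFin {suc n} g = g zero ⊔ maxFin (λ i → g (suc i))

_^ℚ_ : ℚ → ℕ → ℚ
x ^ℚ zero  = 1ℚ
x ^ℚ suc n = x * (x ^ℚ n)

eval2 : ∀ {dT dY} → Poly2 dT dY → ℚ → ℚ → ℚ
eval2 f t y = sumFin (λ i → sumFin (λ j → (f i j ℚ./ 1) * ((t ^ℚ Data.Fin.toℕ i) * (y ^ℚ Data.Fin.toℕ j))))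

norm : ∀ {dT dY} → Poly2 dT dY → ℕ
norm f = 2 ⊔ maxFin (λ i → maxFin (λ j → ∣ f i j ∣))

MonicY : ∀ {dT dY} → Poly2 dT dY → Set
MonicY {dT} {dY} f = (i : Fin (suc dT)) → f i (Data.Fin.fromℕ dY) ≡ (if Data.Fin.toℕ i ℕ.≡ᵇ 0 then ℤ.1ℤ else ℤ.0ℤ)
  where
    open import Relation.Binary.PropositionalEquality using (_≡_)
    open import Data.Bool using (if_then_else_)

DegT : ∀ {dT dY} → Poly2 dT dY → Set
DegT {dT} {dY} f = Σ (Fin (suc dY)) (λ j → ¬ (f (Data.Fin.fromℕ dT) j ≡ ℤ.0ℤ))
  where
    open import Relation.Binary.PropositionalEquality using (_≡_)
    open import Data.Product using (Σ)
    open import Relation.Nullary using (¬_)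

H : ℚ → ℕ
H t = ∣ ↥ t ∣ ⊔ ↧ₙ t

-- Write t = a/b and y = p/q in lowest terms and clear denominators: the bihomogenized
-- polynomial F(a,b,p,q) = b^dT q^dY f(a/b, p/q) vanishes. Since f is monic in Y, the only
-- term without a factor q is b^dT p^dY, so q divides b^dT p^dY, hence b^dT; thus
-- c = y b^dT = p (b^dT / q) is an integer. The remaining terms are bounded by
-- (dT + 1) ‖f‖ H(t)^dT Σ_{j<dY} |p|^j q^(dY-j), and Cauchy's bound for the root p/q gives
-- |c| ≤ (dT + 1) ‖f‖ H(t)^dT + b^dT, at most twice the first summand.
module Submission where

open import Defs
open import Data.Nat as ℕ using (ℕ; suc; _^_)
open import Data.Integer as ℤ using (ℤ; +_; ∣_∣)
open import Data.Rational as ℚ using (ℚ; 0ℚ; _*_; _/_; ↧ₙ_)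
open import Data.Product using (Σ; _×_)
open import Relation.Binary.PropositionalEquality using (_≡_)

open import Algebra.Bundles using (AbelianGroup; CommutativeMonoid)
import Algebra.Properties.CommutativeSemigroup as CommutativeSemigroupProperties
import Algebra.Properties.Group as GroupProperties
import Algebra.Properties.Semiring.Sum as SemiringSum
open import Data.Fin using (Fin; zero; suc; toℕ; inject₁; fromℕ)
open import Data.Fin.Properties using (toℕ-inject₁; toℕ-fromℕ; toℕ≤pred[n])
import Data.Integer.Divisibility.Signed as ℤ∣
import Data.Integer.Properties as ℤP
open import Data.Nat using (zero; _∸_; _⊔_; _≤_; NonZero; >-nonZero; z≤n; s≤s)
import Data.Nat.Coprimality as Coprime
open Coprime using (Coprime; coprime-divisor)
import Data.Nat.Divisibility as ℕ∣
open import Data.Nat.Properties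
import Data.Nat.Tactic.RingSolver as ℕ-Solver
open import Data.Product using (_,_)
open import Data.Rational using (mkℚ; ↥_; ↧_; toℚᵘ)
import Data.Rational.Properties as ℚP
import Data.Rational.Unnormalised as ℚᵘ
import Data.Rational.Unnormalised.Properties as ℚᵘP
open import Function using (_∘_)
open import Relation.Binary.PropositionalEquality
  using (refl; sym; trans; cong; cong₂; subst; module ≡-Reasoning)
open import Relation.Nullary using (yes; no)

module ℕΣ = SemiringSum +-*-semiring
module ℤΣ = SemiringSum ℤP.+-*-semiring

module ℕ* = CommutativeSemigroupProperties *-commutativeSemigroup
module ℚ* = CommutativeSemigroupProperties
  (CommutativeMonoid.commutativeSemigroup ℚP.*-1-commutativeMonoid)

sum-mono-≤ : ∀ {n} {g h : Fin n → ℕ} → (∀ i → g i ≤ h i) → ℕΣ.sum g ≤ ℕΣ.sum h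
sum-mono-≤ {zero}  _   = z≤n
sum-mono-≤ {suc n} g≤h = +-mono-≤ (g≤h zero) (sum-mono-≤ (g≤h ∘ suc))

sum≤n*c : ∀ {n c} {g : Fin n → ℕ} → (∀ i → g i ≤ c) → ℕΣ.sum g ≤ n ℕ.* c
sum≤n*c {zero}  _   = z≤n
sum≤n*c {suc n} g≤c = +-mono-≤ (g≤c zero) (sum≤n*c (g≤c ∘ suc))

∣sum∣≤sum∣∣ : ∀ {n} (g : Fin n → ℤ) → ∣ ℤΣ.sum g ∣ ≤ ℕΣ.sum (∣_∣ ∘ g)
∣sum∣≤sum∣∣ {zero}  g = z≤n
∣sum∣≤sum∣∣ {suc n} g =
  ≤-trans (ℤP.∣i+j∣≤∣i∣+∣j∣ (g zero) _) (+-monoʳ-≤ ∣ g zero ∣ (∣sum∣≤sum∣∣ (g ∘ suc)))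

∣-sum : ∀ {n d} {g : Fin n → ℤ} → (∀ i → d ℤ∣.∣ g i) → d ℤ∣.∣ ℤΣ.sum g
∣-sum {zero}  _   = ℤ∣.divides ℤ.0ℤ refl
∣-sum {suc n} d∣g = ℤ∣.∣m∣n⇒∣m+n (d∣g zero) (∣-sum (d∣g ∘ suc))

abs-^ : ∀ x k → ∣ x ℤ.^ k ∣ ≡ ∣ x ∣ ^ k
abs-^ x zero    = refl
abs-^ x (suc k) = trans (ℤP.abs-* x (x ℤ.^ k)) (cong (∣ x ∣ ℕ.*_) (abs-^ x k))

abs-monomial : ∀ x y i k → ∣ x ℤ.^ i ℤ.* y ℤ.^ k ∣ ≡ ∣ x ∣ ^ i ℕ.* ∣ y ∣ ^ k
abs-monomial x y i k = trans (ℤP.abs-* (x ℤ.^ i) (y ℤ.^ k)) (cong₂ ℕ._*_ (abs-^ x i) (abs-^ y k))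

abs-monomial≤ : ∀ x y {i m} → i ≤ m → ∣ x ℤ.^ i ℤ.* y ℤ.^ (m ∸ i) ∣ ≤ (∣ x ∣ ⊔ ∣ y ∣) ^ m
abs-monomial≤ x y {i} {m} i≤m = begin
  ∣ x ℤ.^ i ℤ.* y ℤ.^ (m ∸ i) ∣ ≡⟨ abs-monomial x y i (m ∸ i) ⟩
  ∣ x ∣ ^ i ℕ.* ∣ y ∣ ^ (m ∸ i) ≤⟨ *-mono-≤ (^-monoˡ-≤ i (m≤m⊔n ∣ x ∣ ∣ y ∣))
                                           (^-monoˡ-≤ (m ∸ i) (m≤n⊔m ∣ x ∣ ∣ y ∣)) ⟩
  M ^ i ℕ.* M ^ (m ∸ i)         ≡⟨ sym (^-distribˡ-+-* M i (m ∸ i)) ⟩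
  M ^ (i ℕ.+ (m ∸ i))           ≡⟨ cong (M ^_) (m+[n∸m]≡n i≤m) ⟩
  M ^ m                         ∎
  where
  open ≤-Reasoning
  M = ∣ x ∣ ⊔ ∣ y ∣

x∣x^[n∸j] : ∀ x {n} (j : Fin n) → x ℤ∣.∣ x ℤ.^ (n ∸ toℕ (inject₁ j))
x∣x^[n∸j] x {suc n} zero    = ℤ∣.∣m⇒∣m*n (x ℤ.^ n) ℤ∣.∣-refl
x∣x^[n∸j] x {suc n} (suc j) = x∣x^[n∸j] x j

coprime-divisor-^ : ∀ {d x y} k → Coprime d x → d ℕ∣.∣ x ^ k ℕ.* y → d ℕ∣.∣ y
coprime-divisor-^ {d} {y = y} zero    _   d∣y = subst (d ℕ∣.∣_) (*-identityˡ y) d∣y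
coprime-divisor-^ {d} {x} {y} (suc k) d⊥x d∣xᵏ⁺¹y =
  coprime-divisor-^ k d⊥x (coprime-divisor d⊥x (subst (d ℕ∣.∣_) (*-assoc x (x ^ k) y) d∣xᵏ⁺¹y))

ι : ℤ → ℚ
ι x = x / 1

ι-mkℚ : ∀ x → ι x ≡ mkℚ x 0 (Coprime.sym (Coprime.1-coprimeTo ∣ x ∣))
ι-mkℚ x = ℚP.↥p/↧p≡p (mkℚ x 0 (Coprime.sym (Coprime.1-coprimeTo ∣ x ∣)))

ι-injective : ∀ {x y} → ι x ≡ ι y → x ≡ y
ι-injective {x} {y} eq rewrite ι-mkℚ x | ι-mkℚ y = cong ↥_ eq

ι-+ : ∀ x y → ι (x ℤ.+ y) ≡ ι x ℚ.+ ι y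
ι-+ x y rewrite ι-mkℚ x | ι-mkℚ y =
  cong (_/ 1) (sym (cong₂ ℤ._+_ (ℤP.*-identityʳ x) (ℤP.*-identityʳ y)))

ι-* : ∀ x y → ι (x ℤ.* y) ≡ ι x * ι y
ι-* x y rewrite ι-mkℚ x | ι-mkℚ y = refl

ι-^ : ∀ x k → ι (x ℤ.^ k) ≡ ι x ^ℚ k
ι-^ x zero    = refl
ι-^ x (suc k) = trans (ι-* x (x ℤ.^ k)) (cong (ι x *_) (ι-^ x k))

ι-monomial : ∀ x y i k → ι (x ℤ.^ i ℤ.* y ℤ.^ k) ≡ ι x ^ℚ i * ι y ^ℚ k
ι-monomial x y i k = trans (ι-* (x ℤ.^ i) (y ℤ.^ k)) (cong₂ _*_ (ι-^ x i) (ι-^ y k))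

ι-sum : ∀ {n} (g : Fin n → ℤ) → ι (ℤΣ.sum g) ≡ sumFin (ι ∘ g)
ι-sum {zero}  g = refl
ι-sum {suc n} g = trans (ι-+ (g zero) _) (cong (ι (g zero) ℚ.+_) (ι-sum (g ∘ suc)))

*ι↧≡ι↥ : ∀ r → r * ι (↧ r) ≡ ι (↥ r)
*ι↧≡ι↥ r@(mkℚ a b _) = ℚP.toℚᵘ-injective (ℚᵘP.≃-trans (ℚP.toℚᵘ-homo-* r (ι (↧ r))) cross)
  where
  cross : toℚᵘ r ℚᵘ.* toℚᵘ (ι (↧ r)) ℚᵘ.≃ toℚᵘ (ι a)
  cross rewrite ι-mkℚ (↧ r) | ι-mkℚ a = ℚᵘ.*≡* (begin
    a ℤ.* ↧ r ℤ.* + 1     ≡⟨ ℤP.*-identityʳ _ ⟩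
    a ℤ.* + suc b         ≡⟨ cong (λ z → a ℤ.* + z) (sym (*-identityʳ (suc b))) ⟩
    a ℤ.* + (suc b ℕ.* 1) ∎)
    where open ≡-Reasoning

↥-coprime-↧ₙ : ∀ r → Coprime ∣ ↥ r ∣ (↧ₙ r)
↥-coprime-↧ₙ (mkℚ _ _ r-coprime) = Coprime.recompute r-coprime

*ι[k*↧]≡ι[↥*k] : ∀ r k → r * ι (+ (k ℕ.* ↧ₙ r)) ≡ ι (↥ r ℤ.* + k)
*ι[k*↧]≡ι[↥*k] r k = begin
  r * ι (+ (k ℕ.* ↧ₙ r))   ≡⟨ cong (λ z → r * ι z) (ℤP.pos-* k (↧ₙ r)) ⟩
  r * ι (+ k ℤ.* ↧ r)      ≡⟨ cong (r *_) (ι-* (+ k) (↧ r)) ⟩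
  r * (ι (+ k) * ι (↧ r))  ≡⟨ ℚ*.x∙yz≈xz∙y r (ι (+ k)) (ι (↧ r)) ⟩
  r * ι (↧ r) * ι (+ k)    ≡⟨ cong (_* ι (+ k)) (*ι↧≡ι↥ r) ⟩
  ι (↥ r) * ι (+ k)        ≡⟨ sym (ι-* (↥ r) (+ k)) ⟩
  ι (↥ r ℤ.* + k)          ∎
  where open ≡-Reasoning

^ℚ-+ : ∀ x i k → x ^ℚ (i ℕ.+ k) ≡ x ^ℚ i * x ^ℚ k
^ℚ-+ x zero    k = sym (ℚP.*-identityˡ (x ^ℚ k))
^ℚ-+ x (suc i) k = trans (cong (x *_) (^ℚ-+ x i k)) (sym (ℚP.*-assoc x _ _))

^ℚ-distrib-* : ∀ x z i → (x * z) ^ℚ i ≡ x ^ℚ i * z ^ℚ i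
^ℚ-distrib-* x z zero    = refl
^ℚ-distrib-* x z (suc i) =
  trans (cong ((x * z) *_) (^ℚ-distrib-* x z i)) (ℚ*.interchange x z (x ^ℚ i) (z ^ℚ i))

^ℚ-split : ∀ x z {i k} → i ≤ k → x ^ℚ i * z ^ℚ k ≡ (x * z) ^ℚ i * z ^ℚ (k ∸ i)
^ℚ-split x z {i} {k} i≤k = begin
  x ^ℚ i * z ^ℚ k                       ≡⟨ cong (λ e → x ^ℚ i * z ^ℚ e) (sym (m+[n∸m]≡n i≤k)) ⟩
  x ^ℚ i * z ^ℚ (i ℕ.+ (k ∸ i))         ≡⟨ cong (x ^ℚ i *_) (^ℚ-+ z i (k ∸ i)) ⟩
  x ^ℚ i * (z ^ℚ i * z ^ℚ (k ∸ i))      ≡⟨ sym (ℚP.*-assoc (x ^ℚ i) _ _) ⟩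
  x ^ℚ i * z ^ℚ i * z ^ℚ (k ∸ i)        ≡⟨ cong (_* z ^ℚ (k ∸ i)) (sym (^ℚ-distrib-* x z i)) ⟩
  (x * z) ^ℚ i * z ^ℚ (k ∸ i)           ∎
  where open ≡-Reasoning

clear-denominator-^ : ∀ r {i k} → i ≤ k →
  r ^ℚ i * ι (↧ r) ^ℚ k ≡ ι (↥ r) ^ℚ i * ι (↧ r) ^ℚ (k ∸ i)
clear-denominator-^ r {i} {k} i≤k =
  trans (^ℚ-split r (ι (↧ r)) i≤k) (cong (λ x → x ^ℚ i * ι (↧ r) ^ℚ (k ∸ i)) (*ι↧≡ι↥ r))

sumFin-cong : ∀ {n} {g h : Fin n → ℚ} → (∀ i → g i ≡ h i) → sumFin g ≡ sumFin h
sumFin-cong {zero}  _   = refl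
sumFin-cong {suc n} g≡h = cong₂ ℚ._+_ (g≡h zero) (sumFin-cong (g≡h ∘ suc))

sumFin-*ʳ : ∀ {n} (g : Fin n → ℚ) c → sumFin g * c ≡ sumFin (λ i → g i * c)
sumFin-*ʳ {zero}  g c = ℚP.*-zeroˡ c
sumFin-*ʳ {suc n} g c =
  trans (ℚP.*-distribʳ-+ c (g zero) _) (cong (g zero * c ℚ.+_) (sumFin-*ʳ (g ∘ suc) c))

≤maxFin : ∀ {n} (g : Fin n → ℕ) i → g i ≤ maxFin g
≤maxFin g zero    = m≤m⊔n _ _
≤maxFin g (suc i) = m≤n⇒m≤o⊔n (g zero) (≤maxFin (g ∘ suc) i)

∣coeff∣≤norm : ∀ {m n} (f : Poly2 m n) i j → ∣ f i j ∣ ≤ norm f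
∣coeff∣≤norm f i j = ≤-trans (≤maxFin (λ j → ∣ f i j ∣) j)
  (≤-trans (≤maxFin (λ i → maxFin (λ j → ∣ f i j ∣)) i) (m≤n⊔m 2 _))

norm-nonZero : ∀ {m n} (f : Poly2 m n) → NonZero (norm f)
norm-nonZero f =
  >-nonZero (≤-trans (s≤s (z≤n {1})) (m≤m⊔n 2 (maxFin (λ i → maxFin (λ j → ∣ f i j ∣)))))

geometricSum : ℕ → ℕ → ℕ → ℕ
geometricSum P q n = ℕΣ.sum {n} λ j → P ^ toℕ j ℕ.* q ^ (n ∸ toℕ j)

geometricSum-telescopes : ∀ q D n →
  D ℕ.* geometricSum (q ℕ.+ D) q n ℕ.+ q ^ suc n ≡ q ℕ.* (q ℕ.+ D) ^ n
geometricSum-telescopes q D zero    = cong (ℕ._+ q ℕ.* 1) (*-zeroʳ D)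
geometricSum-telescopes q D (suc n) = begin
  D ℕ.* (1 ℕ.* X ℕ.+ ℕΣ.sum {n} (λ j → P ℕ.* P ^ toℕ j ℕ.* q ^ (n ∸ toℕ j))) ℕ.+ q ℕ.* X
    ≡⟨ cong (λ s → D ℕ.* (1 ℕ.* X ℕ.+ s) ℕ.+ q ℕ.* X) factorP ⟩
  D ℕ.* (1 ℕ.* X ℕ.+ P ℕ.* S) ℕ.+ q ℕ.* X ≡⟨ regroup D q S X ⟩
  P ℕ.* (D ℕ.* S ℕ.+ X)                   ≡⟨ cong (P ℕ.*_) (geometricSum-telescopes q D n) ⟩
  P ℕ.* (q ℕ.* P ^ n)                     ≡⟨ ℕ*.x∙yz≈y∙xz P q (P ^ n) ⟩
  q ℕ.* P ^ suc n                         ∎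
  where
  open ≡-Reasoning
  P = q ℕ.+ D
  S = geometricSum P q n
  X = q ^ suc n
  factorP : ℕΣ.sum {n} (λ j → P ℕ.* P ^ toℕ j ℕ.* q ^ (n ∸ toℕ j)) ≡ P ℕ.* S
  factorP = trans (ℕΣ.sum-cong-≗ {n} (λ j → *-assoc P _ _)) (sym (ℕΣ.*-distribˡ-sum {n} P _))
  regroup : ∀ D q S X →
    D ℕ.* (1 ℕ.* X ℕ.+ (q ℕ.+ D) ℕ.* S) ℕ.+ q ℕ.* X ≡ (q ℕ.+ D) ℕ.* (D ℕ.* S ℕ.+ X)
  regroup = ℕ-Solver.solve-∀

geometricSum-bound : ∀ {P q} n → q ≤ P → (P ∸ q) ℕ.* geometricSum P q n ≤ q ℕ.* P ^ n
geometricSum-bound {P} {q} n q≤P = ≤-trans (m≤m+n _ (q ^ suc n)) (≤-reflexive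
  (subst (λ P′ → (P ∸ q) ℕ.* geometricSum P′ q n ℕ.+ q ^ suc n ≡ q ℕ.* P′ ^ n)
         (m+[n∸m]≡n q≤P) (geometricSum-telescopes q (P ∸ q) n)))

-- With y = P/q the hypothesis reads W y^n ≤ K Σ_{j<n} y^j, and the conclusion y ≤ 1 + K/W.
cauchy-root-bound : ∀ {P q W K} n →
  W ℕ.* P ^ n ≤ K ℕ.* geometricSum P q n → P ℕ.* W ≤ q ℕ.* (K ℕ.+ W)
cauchy-root-bound {P} {q} {W} {K} n WPⁿ≤KG with P ≤? q
... | yes P≤q = ≤-trans (*-monoˡ-≤ W P≤q) (*-monoʳ-≤ q (m≤n+m W K))
... | no  P≰q = begin
  P ℕ.* W              ≡⟨ cong (ℕ._* W) (sym (m+[n∸m]≡n q≤P)) ⟩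
  (q ℕ.+ D) ℕ.* W      ≡⟨ *-distribʳ-+ W q D ⟩
  q ℕ.* W ℕ.+ D ℕ.* W  ≤⟨ +-monoʳ-≤ (q ℕ.* W) DW≤Kq ⟩
  q ℕ.* W ℕ.+ K ℕ.* q  ≡⟨ collect q W K ⟩
  q ℕ.* (K ℕ.+ W)      ∎
  where
  open ≤-Reasoning
  q≤P = ≰⇒≥ P≰q
  D = P ∸ q
  G = geometricSum P q n
  collect : ∀ q W K → q ℕ.* W ℕ.+ K ℕ.* q ≡ q ℕ.* (K ℕ.+ W)
  collect = ℕ-Solver.solve-∀
  instance
    Pⁿ-nonZero : NonZero (P ^ n)
    Pⁿ-nonZero = m^n≢0 P n {{>-nonZero (≤-<-trans z≤n (≰⇒> P≰q))}}
  DW≤Kq : D ℕ.* W ≤ K ℕ.* q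
  DW≤Kq = *-cancelʳ-≤ _ _ (P ^ n) (begin
    D ℕ.* W ℕ.* P ^ n    ≡⟨ *-assoc D W _ ⟩
    D ℕ.* (W ℕ.* P ^ n)  ≤⟨ *-monoʳ-≤ D WPⁿ≤KG ⟩
    D ℕ.* (K ℕ.* G)      ≡⟨ ℕ*.x∙yz≈y∙xz D K G ⟩
    K ℕ.* (D ℕ.* G)      ≤⟨ *-monoʳ-≤ K (geometricSum-bound n q≤P) ⟩
    K ℕ.* (q ℕ.* P ^ n)  ≡⟨ sym (*-assoc K q _) ⟩
    K ℕ.* q ℕ.* P ^ n    ∎)

-- homogenize f a b p q is b^m q^n f(a/b, p/q); lowerTerms omits its Y^n column.
module _ {m n : ℕ} (f : Poly2 m n) (a b p q : ℤ) where

  homogenizedTerm : Fin (suc m) → Fin (suc n) → ℤ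
  homogenizedTerm i j =
    f i j ℤ.* (a ℤ.^ toℕ i ℤ.* b ℤ.^ (m ∸ toℕ i)) ℤ.* (p ℤ.^ toℕ j ℤ.* q ℤ.^ (n ∸ toℕ j))

  homogenize : ℤ
  homogenize = ℤΣ.sum λ i → ℤΣ.sum λ j → homogenizedTerm i j

  lowerTerms : ℤ
  lowerTerms = ℤΣ.sum λ i → ℤΣ.sum λ j → homogenizedTerm i (inject₁ j)

  homogenize-monic : MonicY f → homogenize ≡ lowerTerms ℤ.+ b ℤ.^ m ℤ.* p ℤ.^ n
  homogenize-monic monic = begin
    homogenize
      ≡⟨ ℤΣ.sum-cong-≗ {suc m} (λ i → ℤΣ.sum-init-last {n} (homogenizedTerm i)) ⟩
    ℤΣ.sum (λ i → ℤΣ.sum (λ j → homogenizedTerm i (inject₁ j)) ℤ.+ homogenizedTerm i (fromℕ n))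
      ≡⟨ ℤΣ.∑-distrib-+ (λ i → ℤΣ.sum (λ j → homogenizedTerm i (inject₁ j))) leadingColumn ⟩
    lowerTerms ℤ.+ ℤΣ.sum leadingColumn
      ≡⟨ cong (ℤ._+_ lowerTerms) sum-leadingColumn ⟩
    lowerTerms ℤ.+ b ℤ.^ m ℤ.* p ℤ.^ n ∎
    where
    open ≡-Reasoning
    leadingColumn : Fin (suc m) → ℤ
    leadingColumn i = homogenizedTerm i (fromℕ n)
    leadingTerm : homogenizedTerm zero (fromℕ n) ≡ b ℤ.^ m ℤ.* p ℤ.^ n
    leadingTerm rewrite monic zero | toℕ-fromℕ n | n∸n≡0 n =
      cong₂ ℤ._*_ (trans (ℤP.*-identityˡ _) (ℤP.*-identityˡ (b ℤ.^ m))) (ℤP.*-identityʳ (p ℤ.^ n))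
    vanishing : ∀ i → homogenizedTerm (suc i) (fromℕ n) ≡ ℤ.0ℤ
    vanishing i rewrite monic (suc i) = refl
    sum-leadingColumn : ℤΣ.sum leadingColumn ≡ b ℤ.^ m ℤ.* p ℤ.^ n
    sum-leadingColumn = begin
      leadingColumn zero ℤ.+ ℤΣ.sum (leadingColumn ∘ suc)
        ≡⟨ cong₂ ℤ._+_ leadingTerm (trans (ℤΣ.sum-cong-≗ vanishing) (ℤΣ.sum-replicate-zero m)) ⟩
      b ℤ.^ m ℤ.* p ℤ.^ n ℤ.+ ℤ.0ℤ
        ≡⟨ ℤP.+-identityʳ _ ⟩
      b ℤ.^ m ℤ.* p ℤ.^ n ∎

  q∣lowerTerms : q ℤ∣.∣ lowerTerms
  q∣lowerTerms = ∣-sum {suc m} λ i → ∣-sum {n} λ j →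
    ℤ∣.∣n⇒∣m*n (f i (inject₁ j) ℤ.* (a ℤ.^ toℕ i ℤ.* b ℤ.^ (m ∸ toℕ i)))
      (ℤ∣.∣n⇒∣m*n (p ℤ.^ toℕ (inject₁ j)) (x∣x^[n∸j] q j))

  ∣homogenizedTerm∣≤ : ∀ i j → ∣ homogenizedTerm i j ∣ ≤
    norm f ℕ.* (∣ a ∣ ⊔ ∣ b ∣) ^ m ℕ.* (∣ p ∣ ^ toℕ j ℕ.* ∣ q ∣ ^ (n ∸ toℕ j))
  ∣homogenizedTerm∣≤ i j = begin
    ∣ homogenizedTerm i j ∣
      ≡⟨ trans (ℤP.abs-* (f i j ℤ.* ab) pq) (cong (ℕ._* ∣ pq ∣) (ℤP.abs-* (f i j) ab)) ⟩
    ∣ f i j ∣ ℕ.* ∣ ab ∣ ℕ.* ∣ pq ∣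
      ≤⟨ *-monoˡ-≤ ∣ pq ∣ (*-mono-≤ (∣coeff∣≤norm f i j) (abs-monomial≤ a b (toℕ≤pred[n] i))) ⟩
    norm f ℕ.* (∣ a ∣ ⊔ ∣ b ∣) ^ m ℕ.* ∣ pq ∣
      ≡⟨ cong (norm f ℕ.* (∣ a ∣ ⊔ ∣ b ∣) ^ m ℕ.*_) (abs-monomial p q (toℕ j) (n ∸ toℕ j)) ⟩
    norm f ℕ.* (∣ a ∣ ⊔ ∣ b ∣) ^ m ℕ.* (∣ p ∣ ^ toℕ j ℕ.* ∣ q ∣ ^ (n ∸ toℕ j)) ∎
    where
    open ≤-Reasoning
    ab = a ℤ.^ toℕ i ℤ.* b ℤ.^ (m ∸ toℕ i)
    pq = p ℤ.^ toℕ j ℤ.* q ℤ.^ (n ∸ toℕ j)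

  ∣lowerTerms∣≤ : ∣ lowerTerms ∣ ≤
    suc m ℕ.* (norm f ℕ.* (∣ a ∣ ⊔ ∣ b ∣) ^ m) ℕ.* geometricSum ∣ p ∣ ∣ q ∣ n
  ∣lowerTerms∣≤ = begin
    ∣ lowerTerms ∣               ≤⟨ ∣sum∣≤sum∣∣ row ⟩
    ℕΣ.sum (λ i → ∣ row i ∣)      ≤⟨ sum≤n*c rowBound ⟩
    suc m ℕ.* (C ℕ.* G)          ≡⟨ sym (*-assoc (suc m) C G) ⟩
    suc m ℕ.* C ℕ.* G            ∎
    where
    open ≤-Reasoning
    C = norm f ℕ.* (∣ a ∣ ⊔ ∣ b ∣) ^ m
    G = geometricSum ∣ p ∣ ∣ q ∣ n
    row : Fin (suc m) → ℤ
    row i = ℤΣ.sum λ j → homogenizedTerm i (inject₁ j)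
    geometricTerm : Fin n → ℕ
    geometricTerm j = ∣ p ∣ ^ toℕ j ℕ.* ∣ q ∣ ^ (n ∸ toℕ j)
    rowBound : ∀ i → ∣ row i ∣ ≤ C ℕ.* G
    rowBound i = begin
      ∣ row i ∣                                    ≤⟨ ∣sum∣≤sum∣∣ (homogenizedTerm i ∘ inject₁) ⟩
      ℕΣ.sum (∣_∣ ∘ homogenizedTerm i ∘ inject₁)   ≤⟨ sum-mono-≤ termBound ⟩
      ℕΣ.sum (λ j → C ℕ.* geometricTerm j)         ≡⟨ sym (ℕΣ.*-distribˡ-sum C geometricTerm) ⟩
      C ℕ.* G                                      ∎
      where
      termBound : ∀ j → ∣ homogenizedTerm i (inject₁ j) ∣ ≤ C ℕ.* geometricTerm j
      termBound j = subst (λ k → ∣ homogenizedTerm i (inject₁ j) ∣ ≤ C ℕ.* (∣ p ∣ ^ k ℕ.* ∣ q ∣ ^ (n ∸ k)))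
                          (toℕ-inject₁ j) (∣homogenizedTerm∣≤ i (inject₁ j))

  module _ (monic : MonicY f) (root : homogenize ≡ ℤ.0ℤ) where

    leading≡-lowerTerms : b ℤ.^ m ℤ.* p ℤ.^ n ≡ ℤ.- lowerTerms
    leading≡-lowerTerms = GroupProperties.inverseʳ-unique ℤ+-group lowerTerms _
      (trans (sym (homogenize-monic monic)) root)
      where ℤ+-group = AbelianGroup.group ℤP.+-0-abelianGroup

    denominator-divides : Coprime ∣ p ∣ ∣ q ∣ → ∣ q ∣ ℕ∣.∣ ∣ b ∣ ^ m
    denominator-divides p⊥q = coprime-divisor-^ n (Coprime.sym p⊥q)
      (subst (∣ q ∣ ℕ∣.∣_) (trans (abs-monomial b p m n) (*-comm (∣ b ∣ ^ m) (∣ p ∣ ^ n)))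
        (ℤ∣.∣⇒∣ᵤ (subst (q ℤ∣.∣_) (sym leading≡-lowerTerms) (ℤ∣.∣m⇒∣-m q∣lowerTerms))))

    numerator-bound : ∣ p ∣ ℕ.* ∣ b ∣ ^ m ≤
      ∣ q ∣ ℕ.* (suc m ℕ.* (norm f ℕ.* (∣ a ∣ ⊔ ∣ b ∣) ^ m) ℕ.+ ∣ b ∣ ^ m)
    numerator-bound = cauchy-root-bound {∣ p ∣} {∣ q ∣} {∣ b ∣ ^ m} n (begin
      ∣ b ∣ ^ m ℕ.* ∣ p ∣ ^ n        ≡⟨ sym (abs-monomial b p m n) ⟩
      ∣ b ℤ.^ m ℤ.* p ℤ.^ n ∣        ≡⟨ cong ∣_∣ leading≡-lowerTerms ⟩
      ∣ ℤ.- lowerTerms ∣             ≡⟨ ℤP.∣-i∣≡∣i∣ lowerTerms ⟩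
      ∣ lowerTerms ∣                 ≤⟨ ∣lowerTerms∣≤ ⟩
      suc m ℕ.* (norm f ℕ.* (∣ a ∣ ⊔ ∣ b ∣) ^ m) ℕ.* geometricSum ∣ p ∣ ∣ q ∣ n ∎)
      where open ≤-Reasoning

    root-numerator-bound : .{{NonZero ∣ q ∣}} → Coprime ∣ p ∣ ∣ q ∣ → Σ ℕ λ k →
      ∣ b ∣ ^ m ≡ k ℕ.* ∣ q ∣ × ∣ p ∣ ℕ.* k ≤ 2 ℕ.* (m ℕ.+ 1) ℕ.* norm f ℕ.* (∣ a ∣ ⊔ ∣ b ∣) ^ m
    root-numerator-bound p⊥q = k , bᵐ≡kq , (begin
      ∣ p ∣ ℕ.* k                            ≤⟨ *-cancelʳ-≤ _ _ ∣ q ∣ pkq≤[K+W]q ⟩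
      K ℕ.+ W                                ≤⟨ +-monoʳ-≤ K W≤K ⟩
      K ℕ.+ K                                ≡⟨ double m (norm f) (M ^ m) ⟩
      2 ℕ.* (m ℕ.+ 1) ℕ.* norm f ℕ.* M ^ m   ∎)
      where
      open ≤-Reasoning
      open ℕ∣._∣_ (denominator-divides p⊥q) renaming (quotient to k; equality to bᵐ≡kq)
      M = ∣ a ∣ ⊔ ∣ b ∣
      W = ∣ b ∣ ^ m
      K = suc m ℕ.* (norm f ℕ.* M ^ m)
      pkq≤[K+W]q : ∣ p ∣ ℕ.* k ℕ.* ∣ q ∣ ≤ (K ℕ.+ W) ℕ.* ∣ q ∣
      pkq≤[K+W]q = begin
        ∣ p ∣ ℕ.* k ℕ.* ∣ q ∣    ≡⟨ *-assoc (∣ p ∣) k (∣ q ∣) ⟩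
        ∣ p ∣ ℕ.* (k ℕ.* ∣ q ∣)  ≡⟨ cong (∣ p ∣ ℕ.*_) (sym bᵐ≡kq) ⟩
        ∣ p ∣ ℕ.* W              ≤⟨ numerator-bound ⟩
        ∣ q ∣ ℕ.* (K ℕ.+ W)      ≡⟨ *-comm (∣ q ∣) (K ℕ.+ W) ⟩
        (K ℕ.+ W) ℕ.* ∣ q ∣      ∎
      W≤K : W ≤ K
      W≤K = begin
        W                   ≤⟨ ^-monoˡ-≤ m (m≤n⊔m ∣ a ∣ ∣ b ∣) ⟩
        M ^ m               ≤⟨ m≤n*m (M ^ m) (norm f) {{norm-nonZero f}} ⟩
        norm f ℕ.* M ^ m    ≤⟨ m≤n*m (norm f ℕ.* M ^ m) (suc m) ⟩
        K                   ∎
      double : ∀ m N X → suc m ℕ.* (N ℕ.* X) ℕ.+ suc m ℕ.* (N ℕ.* X) ≡ 2 ℕ.* (m ℕ.+ 1) ℕ.* N ℕ.* X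
      double = ℕ-Solver.solve-∀

homogenize-eval2 : ∀ {m n} (f : Poly2 m n) t y →
  eval2 f t y * ι (↧ t ℤ.^ m ℤ.* ↧ y ℤ.^ n) ≡ ι (homogenize f (↥ t) (↧ t) (↥ y) (↧ y))
homogenize-eval2 {m} {n} f t y = begin
  eval2 f t y * c
    ≡⟨ trans (sumFin-*ʳ (λ i → sumFin (monomial i)) c) (sumFin-cong (λ i → sumFin-*ʳ (monomial i) c)) ⟩
  sumFin (λ i → sumFin (λ j → monomial i j * c))
    ≡⟨ sumFin-cong (λ i → sumFin-cong (clearTerm i)) ⟩
  sumFin (λ i → sumFin (λ j → ι (homogenizedTerm f a b p q i j)))
    ≡⟨ sym (trans (ι-sum (λ i → ℤΣ.sum (homogenizedTerm f a b p q i)))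
                   (sumFin-cong (λ i → ι-sum (homogenizedTerm f a b p q i)))) ⟩
  ι (homogenize f a b p q) ∎
  where
  open ≡-Reasoning
  monomial : Fin (suc m) → Fin (suc n) → ℚ
  monomial i j = ι (f i j) * (t ^ℚ toℕ i * y ^ℚ toℕ j)
  a = ↥ t
  b = ↧ t
  p = ↥ y
  q = ↧ y
  c = ι (b ℤ.^ m ℤ.* q ℤ.^ n)
  regroup : ∀ F T Y B Q → F * (T * Y) * (B * Q) ≡ F * (T * B) * (Y * Q)
  regroup F T Y B Q = trans (ℚP.*-assoc F _ _)
    (trans (cong (F *_) (ℚ*.interchange T Y B Q)) (sym (ℚP.*-assoc F _ _)))
  clearTerm : ∀ i j → monomial i j * c ≡ ι (homogenizedTerm f a b p q i j)
  clearTerm i j = begin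
    ι F * (t ^ℚ i′ * y ^ℚ j′) * c
      ≡⟨ cong (ι F * (t ^ℚ i′ * y ^ℚ j′) *_) (ι-monomial b q m n) ⟩
    ι F * (t ^ℚ i′ * y ^ℚ j′) * (ι b ^ℚ m * ι q ^ℚ n)
      ≡⟨ regroup (ι F) (t ^ℚ i′) (y ^ℚ j′) (ι b ^ℚ m) (ι q ^ℚ n) ⟩
    ι F * (t ^ℚ i′ * ι b ^ℚ m) * (y ^ℚ j′ * ι q ^ℚ n)
      ≡⟨ cong₂ (λ u v → ι F * u * v) (clear-denominator-^ t (toℕ≤pred[n] i))
                                     (clear-denominator-^ y (toℕ≤pred[n] j)) ⟩
    ι F * (ι a ^ℚ i′ * ι b ^ℚ (m ∸ i′)) * (ι p ^ℚ j′ * ι q ^ℚ (n ∸ j′))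
      ≡⟨ sym (cong₂ (λ u v → ι F * u * v) (ι-monomial a b i′ (m ∸ i′)) (ι-monomial p q j′ (n ∸ j′))) ⟩
    ι F * ι A * ι B
      ≡⟨ sym (trans (ι-* (F ℤ.* A) B) (cong (_* ι B) (ι-* F A))) ⟩
    ι (F ℤ.* A ℤ.* B) ∎
    where
    i′ = toℕ i
    j′ = toℕ j
    F = f i j
    A = a ℤ.^ i′ ℤ.* b ℤ.^ (m ∸ i′)
    B = p ℤ.^ j′ ℤ.* q ℤ.^ (n ∸ j′)

homogenize-root : ∀ {m n} (f : Poly2 m n) t y →
  eval2 f t y ≡ 0ℚ → homogenize f (↥ t) (↧ t) (↥ y) (↧ y) ≡ ℤ.0ℤ
homogenize-root {m} {n} f t y f[t,y]≡0 = ι-injective (begin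
  ι (homogenize f (↥ t) (↧ t) (↥ y) (↧ y)) ≡⟨ sym (homogenize-eval2 f t y) ⟩
  eval2 f t y * c                          ≡⟨ cong (_* c) f[t,y]≡0 ⟩
  0ℚ * c                                   ≡⟨ ℚP.*-zeroˡ c ⟩
  0ℚ                                       ∎)
  where
  open ≡-Reasoning
  c = ι (↧ t ℤ.^ m ℤ.* ↧ y ℤ.^ n)

lemma2p4 : (dT dY : ℕ) (f : Poly2 dT dY) → MonicY f → DegT f →
    (t y : ℚ) → eval2 f t y ≡ 0ℚ →
    Σ ℤ (λ c → (y * ((+ ((↧ₙ t) ^ dT)) / 1) ≡ c / 1)
      × (∣ c ∣ ℕ.≤ 2 ℕ.* (dT ℕ.+ 1) ℕ.* norm f ℕ.* (H t ^ dT)))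
lemma2p4 dT dY f monic _ t y f[t,y]≡0 =
  let k , bᵈ≡kq , ∣p∣k≤bound = root-numerator-bound f (↥ t) (↧ t) (↥ y) (↧ y) monic
                                 (homogenize-root f t y f[t,y]≡0) (↥-coprime-↧ₙ y)
  in ↥ y ℤ.* + k
   , trans (cong (λ W → y * ι (+ W)) bᵈ≡kq) (*ι[k*↧]≡ι[↥*k] y k)
   , subst (_≤ _) (sym (ℤP.abs-* (↥ y) (+ k))) ∣p∣k≤bound
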